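{- Let $m,k$ be positive integers. There is a bijection between $\mathcal{SD}(2m,2k)$ and $\mathcal{SD}(2m+1,2k)$.
   Context: For positive $s$ and positive integer $k$, an $(s,k)$-Dyck path is a lattice path from $(0,0)$ to $(s,0)$ using up steps $(k/2,1)$, down steps $(k/2,-1)$ and horizontal steps $(\ell,0)$ with $\ell$ an integer, $1\le\ell<k$, never going below the $x$-axis. It is symmetric if its reflection about the line $x=s/2$ is itself. $\mathcal{SD}(s,k)$ denotes the set of symmetric $(s,k)$-Dyck paths. -}

module Defs where

open import Data.Nat using (ℕ; _+_; _*_; _≤_; _<_)
open import Data.Integer as ℤ using (ℤ; +_; 0ℤ)
open import Data.List using (List; []; _∷_; map; reverse; inits)
open import Data.List.Relation.Unary.All using (All)
open import Data.Product using (Σ; _×_)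
open import Relation.Binary.PropositionalEquality using (_≡_)

-- To keep everything integral we measure
-- x-coordinates in HALF units: an up step (k/2, 1) and a down step
-- (k/2,-1) have doubled width k, a horizontal step (ℓ,0) with 1 ≤ ℓ < k
-- has doubled width 2ℓ, and the path must end at doubled abscissa 2s.
data Step (k : ℕ) : Set where
  U : Step k
  D : Step k
  H : (ℓ : ℕ) → 1 ≤ ℓ → ℓ < k → Step k

stepWidth : {k : ℕ} → Step k → ℕ
stepWidth {k} U = k
stepWidth {k} D = k
stepWidth (H ℓ _ _) = 2 * ℓ

width : {k : ℕ} → List (Step k) → ℕ
width [] = 0
width (x ∷ p) = stepWidth x + width p

stepRise : {k : ℕ} → Step k → ℤ
stepRise U = + 1
stepRise D = ℤ.- (+ 1)
stepRise (H _ _ _) = 0ℤ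

height : {k : ℕ} → List (Step k) → ℤ
height [] = 0ℤ
height (x ∷ p) = stepRise x ℤ.+ height p

IsDyck : (s k : ℕ) → List (Step k) → Set
IsDyck s k p = (width p ≡ 2 * s) × (height p ≡ 0ℤ) × All (λ q → 0ℤ ℤ.≤ height q) (inits p)

-- reflection about the vertical line x = s/2: reverse the step sequence,
-- swapping up and down steps (horizontal steps are unchanged).
flipStep : {k : ℕ} → Step k → Step k
flipStep U = D
flipStep D = U
flipStep (H ℓ p q) = H ℓ p q

reflect : {k : ℕ} → List (Step k) → List (Step k)
reflect p = reverse (map flipStep p)

IsSymmetric : {k : ℕ} → List (Step k) → Set
IsSymmetric p = reflect p ≡ p

SD : (s k : ℕ) → Set
SD s k = Σ (List (Step k)) (λ p → IsDyck s k p × IsSymmetric p)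

-- A symmetric step sequence p (reflect p ≡ p) is a palindrome
-- q ++ centre n ++ reflect q, where the centre is either empty (n = 0) or
-- a single horizontal step of length n ≥ 1; the pair (q , n) is unique.
-- Deleting or inserting a horizontal step changes neither the final height
-- nor the height of any prefix, so whether q ++ centre n ++ reflect q is a
-- Dyck path does not depend on n except through its width, which is
-- 2·(width q + n) in doubled units.  Every step of a (·,2k)-path has even
-- doubled width (2k for up/down steps, 2ℓ for horizontal ones), so width q
-- is even and the centre length n has the parity of s.  Hence for s = 2m the centre n is
-- even and n ↦ n + 1 stays below 2k, while for s = 2m + 1 the centre is
-- odd, in particular nonempty, and n ↦ n − 1 inverts it.
module Submission where

open import Defs
open import Data.Nat using (ℕ; _+_; _*_; _≤_)
open import Function.Bundles using (_⤖_)

open import Data.Nat using (zero; suc; _<_; s≤s; z≤n)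
open import Data.Nat.Properties
  using (+-assoc; +-comm; +-suc; +-identityʳ; *-comm; *-cancelˡ-≡; suc-injective;
         ≤-refl; ≤-trans; <⇒≤; ≤∧≢⇒<; ≤-irrelevant; <-irrelevant; m≤m+n; even≢odd; _≟_)
  renaming (≡-irrelevant to ℕ-≡-irrelevant)
open import Data.Nat.Divisibility using (_∣_; divides; ∣m∣n⇒∣m+n; ∣m+n∣m⇒∣n; m∣m*n)
open import Data.Nat.Tactic.RingSolver using (solve-∀)
open import Data.Integer as ℤ using (0ℤ)
import Data.Integer.Properties as ℤP
open import Data.List using (List; []; _∷_; map; reverse; inits; _++_; _∷ʳ_; length; [_])
import Data.List.Properties as LP
open import Data.List.Reverse using (reverseView; []; _∶_∶ʳ_)
open import Data.List.Relation.Unary.All as All using (All; _∷_)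
import Data.List.Relation.Unary.All.Properties as AllP
open import Data.Product using (_×_; _,_; proj₁; proj₂)
open import Data.Empty using (⊥-elim)
open import Relation.Binary.PropositionalEquality using (_≡_; refl; sym; trans; cong; cong₂; subst; module ≡-Reasoning)
open import Relation.Nullary using (yes; no; ¬_)
open import Relation.Binary.Definitions using (DecidableEquality)
open import Function.Bundles using (mk↔ₛ′)
open import Function.Base using (_∘_; id)
open import Function.Properties.Inverse using (↔⇒⤖)
open import Axiom.UniquenessOfIdentityProofs using (module Decidable⇒UIP)

module _ {A : Set} where

  inits-remove : ∀ {P : List A → Set} (a : List A) {x : A} (b : List A) →
                 (∀ r → P (a ++ x ∷ r) → P (a ++ r)) →
                 All P (inits (a ++ x ∷ b)) → All P (inits (a ++ b))
  inits-remove []      b keep (_ ∷ ps)  = All.map (λ {r} → keep r) (AllP.map⁻ ps)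
  inits-remove (y ∷ a) b keep (p₀ ∷ ps) = p₀ ∷ AllP.map⁺ (inits-remove a b keep (AllP.map⁻ ps))

  inits-insert : ∀ {P : List A → Set} (a : List A) {x : A} (b : List A) →
                 (∀ r → P (a ++ r) → P (a ++ x ∷ r)) →
                 All P (inits (a ++ b)) → All P (inits (a ++ x ∷ b))
  inits-insert []      b add ps@(p₀ ∷ _) = p₀ ∷ AllP.map⁺ (All.map (λ {r} → add r) ps)
  inits-insert (y ∷ a) b add (p₀ ∷ ps)   = p₀ ∷ AllP.map⁺ (inits-insert a b add (AllP.map⁻ ps))

module _ {K : ℕ} where

  flipStep-involutive : (x : Step K) → flipStep (flipStep x) ≡ x
  flipStep-involutive U         = refl
  flipStep-involutive D         = refl
  flipStep-involutive (H _ _ _) = refl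

  reflect-++ : (a b : List (Step K)) → reflect (a ++ b) ≡ reflect b ++ reflect a
  reflect-++ a b = trans (cong reverse (LP.map-++ flipStep a b))
                         (LP.reverse-++ (map flipStep a) (map flipStep b))

  reflect-involutive : (a : List (Step K)) → reflect (reflect a) ≡ a
  reflect-involutive a = begin
    reverse (map flipStep (reverse (map flipStep a)))  ≡⟨ cong reverse (LP.reverse-map flipStep (map flipStep a)) ⟩
    reverse (reverse (map flipStep (map flipStep a)))  ≡⟨ LP.reverse-involutive _ ⟩
    map flipStep (map flipStep a)                      ≡⟨ LP.map-∘ a ⟨
    map (λ x → flipStep (flipStep x)) a                ≡⟨ LP.map-cong flipStep-involutive a ⟩
    map (λ x → x) a                                    ≡⟨ LP.map-id a ⟩
    a                                                  ∎
    where open ≡-Reasoning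

  width-++ : (a b : List (Step K)) → width (a ++ b) ≡ width a + width b
  width-++ []      b = refl
  width-++ (x ∷ a) b = trans (cong (stepWidth x +_) (width-++ a b)) (sym (+-assoc (stepWidth x) _ _))

  stepWidth-flip : (x : Step K) → stepWidth (flipStep x) ≡ stepWidth x
  stepWidth-flip U         = refl
  stepWidth-flip D         = refl
  stepWidth-flip (H _ _ _) = refl

  width-reflect : (a : List (Step K)) → width (reflect a) ≡ width a
  width-reflect []      = refl
  width-reflect (x ∷ a) = begin
    width (reflect (x ∷ a))                           ≡⟨ cong width (reflect-++ [ x ] a) ⟩
    width (reflect a ++ [ flipStep x ])               ≡⟨ width-++ (reflect a) _ ⟩
    width (reflect a) + (stepWidth (flipStep x) + 0)  ≡⟨ cong₂ _+_ (width-reflect a) (trans (+-identityʳ _) (stepWidth-flip x)) ⟩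
    width a + stepWidth x                             ≡⟨ +-comm (width a) _ ⟩
    width (x ∷ a)                                     ∎
    where open ≡-Reasoning

  centre : (n : ℕ) → n < K → List (Step K)
  centre zero    _   = []
  centre (suc n) n<K = [ H (suc n) (s≤s z≤n) n<K ]

  centre-injective : ∀ {n n'} {h : n < K} {h' : n' < K} → centre n h ≡ centre n' h' → n ≡ n'
  centre-injective {zero}  {zero}  refl = refl
  centre-injective {suc n} {suc n} refl = refl

  centre-width : (n : ℕ) (h : n < K) → width (centre n h) ≡ 2 * n
  centre-width zero    h = refl
  centre-width (suc n) h = +-identityʳ _

  palin : List (Step K) → (n : ℕ) → n < K → List (Step K)
  palin q n h = q ++ centre n h ++ reflect q

  palin-symmetric : (q : List (Step K)) (n : ℕ) (h : n < K) → IsSymmetric (palin q n h)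
  palin-symmetric q n h = begin
    reflect (q ++ c ++ reflect q)              ≡⟨ reflect-++ q _ ⟩
    reflect (c ++ reflect q) ++ reflect q      ≡⟨ cong (_++ reflect q) (reflect-++ c (reflect q)) ⟩
    (reflect (reflect q) ++ reflect c) ++ reflect q
      ≡⟨ cong (λ z → (z ++ reflect c) ++ reflect q) (reflect-involutive q) ⟩
    (q ++ reflect c) ++ reflect q              ≡⟨ cong (λ z → (q ++ z) ++ reflect q) (reflect-centre n h) ⟩
    (q ++ c) ++ reflect q                      ≡⟨ LP.++-assoc q c _ ⟩
    q ++ c ++ reflect q                        ∎
    where
    open ≡-Reasoning
    c = centre n h
    reflect-centre : (n : ℕ) (h : n < K) → reflect (centre n h) ≡ centre n h
    reflect-centre zero    h = refl
    reflect-centre (suc n) h = refl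

  palin-width : (q : List (Step K)) (n : ℕ) (h : n < K) → width (palin q n h) ≡ 2 * (width q + n)
  palin-width q n h = begin
    width (q ++ centre n h ++ reflect q)               ≡⟨ width-++ q _ ⟩
    width q + width (centre n h ++ reflect q)          ≡⟨ cong (width q +_) (width-++ (centre n h) _) ⟩
    width q + (width (centre n h) + width (reflect q))
      ≡⟨ cong₂ (λ u v → width q + (u + v)) (centre-width n h) (width-reflect q) ⟩
    width q + (2 * n + width q)                        ≡⟨ double (width q) n ⟩
    2 * (width q + n)                                  ∎
    where
    open ≡-Reasoning
    double : ∀ w n → w + (2 * n + w) ≡ 2 * (w + n)
    double = solve-∀

  palin-cons : (x : Step K) (q : List (Step K)) (n : ℕ) (h : n < K) →
               x ∷ (palin q n h ∷ʳ flipStep x) ≡ palin (x ∷ q) n h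
  palin-cons x q n h = cong (x ∷_) (begin
    (q ++ c ++ reflect q) ++ [ flipStep x ]   ≡⟨ LP.++-assoc q (c ++ reflect q) _ ⟩
    q ++ ((c ++ reflect q) ++ [ flipStep x ]) ≡⟨ cong (q ++_) (LP.++-assoc c (reflect q) _) ⟩
    q ++ c ++ (reflect q ++ [ flipStep x ])   ≡⟨ cong (λ z → q ++ c ++ z) (reflect-++ [ x ] q) ⟨
    q ++ c ++ reflect (x ∷ q)                 ∎)
    where
    open ≡-Reasoning
    c = centre n h

  data Palindrome (p : List (Step K)) : Set where
    palindrome : (q : List (Step K)) (n : ℕ) (h : n < K) → p ≡ palin q n h → Palindrome p

  palindrome-wrap : ∀ {x y : Step K} {r : List (Step K)} →
                    y ≡ flipStep x → Palindrome r → Palindrome (x ∷ (r ∷ʳ y))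
  palindrome-wrap {x} refl (palindrome q n h r≡) =
    palindrome (x ∷ q) n h (trans (cong (λ u → x ∷ (u ∷ʳ flipStep x)) r≡) (palin-cons x q n h))

  -- Every symmetric step sequence is a palindrome: peel off the first and
  -- last step (mirror images of each other) and recurse; the recursion is
  -- bounded by the length of the sequence.
  decompose : 0 < K → (p : List (Step K)) → IsSymmetric p → Palindrome p
  decompose 0<K p = peel (length p) p ≤-refl
    where
    peel : (fuel : ℕ) (p : List (Step K)) → length p ≤ fuel → IsSymmetric p → Palindrome p
    peel _ []      _ _ = palindrome [] 0 0<K refl
    peel fuel (x ∷ t) bound sym-p with reverseView t
    peel _ (U ∷ .[])                 _ () | []
    peel _ (D ∷ .[])                 _ () | []
    peel _ (H _ (s≤s z≤n) ℓ<K ∷ .[]) _ _  | [] = palindrome [] _ ℓ<K refl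
    peel (suc fuel) (x ∷ .(r ∷ʳ y)) (s≤s bound) sym-p | r ∶ _ ∶ʳ y =
      palindrome-wrap y≡flip (peel fuel r (≤-trans (LP.length-++-≤ˡ r) bound) sym-r)
      where
      mirrored : flipStep y ∷ (reflect r ∷ʳ flipStep x) ≡ x ∷ (r ∷ʳ y)
      mirrored = trans (sym (trans (reflect-++ [ x ] (r ∷ʳ y))
                                   (cong (_++ [ flipStep x ]) (reflect-++ r [ y ])))) sym-p
      sym-r : IsSymmetric r
      sym-r = LP.∷ʳ-injectiveˡ (reflect r) r (LP.∷-injectiveʳ mirrored)
      y≡flip : y ≡ flipStep x
      y≡flip = sym (LP.∷ʳ-injectiveʳ (reflect r) r (LP.∷-injectiveʳ mirrored))

  -- A centre has at most one step, so it is never the palindrome with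
  -- nonempty half used in the two mixed cases of palin-unique.
  centre-not-wrapped : ∀ {n} {h : n < K} {x y : Step K} {r : List (Step K)} →
                       ¬ (centre n h ++ [] ≡ x ∷ (r ∷ʳ y))
  centre-not-wrapped {zero}  ()
  centre-not-wrapped {suc n} {r = []}    ()
  centre-not-wrapped {suc n} {r = _ ∷ _} ()

  palin-unique : ∀ (q q' : List (Step K)) {n n'} {h : n < K} {h' : n' < K} →
                 palin q n h ≡ palin q' n' h' → q ≡ q' × n ≡ n'
  palin-unique []      []       e = refl , centre-injective (trans (sym (LP.++-identityʳ _))
                                                                  (trans e (LP.++-identityʳ _)))
  palin-unique []      (x' ∷ q') e = ⊥-elim (centre-not-wrapped (trans e (sym (palin-cons x' q' _ _))))
  palin-unique (x ∷ q) []       e = ⊥-elim (centre-not-wrapped (trans (sym e) (sym (palin-cons x q _ _))))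
  palin-unique (x ∷ q) (x' ∷ q') e
    with mirrored ← trans (palin-cons x q _ _) (trans e (sym (palin-cons x' q' _ _)))
    with refl , inner ← LP.∷-injective mirrored
    with refl , refl ← palin-unique q q' (LP.∷ʳ-injectiveˡ _ _ inner) = refl , refl

  height-skip-flat : (a : List (Step K)) {ℓ : ℕ} {u : 1 ≤ ℓ} {v : ℓ < K} (r : List (Step K)) →
                     height (a ++ H ℓ u v ∷ r) ≡ height (a ++ r)
  height-skip-flat []      r = ℤP.+-identityˡ (height r)
  height-skip-flat (y ∷ a) r = cong (λ t → stepRise y ℤ.+ t) (height-skip-flat a r)

  Balanced : List (Step K) → Set
  Balanced p = height p ≡ 0ℤ × All (λ r → 0ℤ ℤ.≤ height r) (inits p)

  flat-remove : (a b : List (Step K)) {ℓ : ℕ} {u : 1 ≤ ℓ} {v : ℓ < K} →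
                Balanced (a ++ H ℓ u v ∷ b) → Balanced (a ++ b)
  flat-remove a b (ends , above) =
    trans (sym (height-skip-flat a b)) ends ,
    inits-remove a b (λ r → subst (0ℤ ℤ.≤_) (height-skip-flat a r)) above

  flat-insert : (a b : List (Step K)) {ℓ : ℕ} {u : 1 ≤ ℓ} {v : ℓ < K} →
                Balanced (a ++ b) → Balanced (a ++ H ℓ u v ∷ b)
  flat-insert a b (ends , above) =
    trans (height-skip-flat a b) ends ,
    inits-insert a b (λ r → subst (0ℤ ℤ.≤_) (sym (height-skip-flat a r))) above

  recentre-balanced : (q : List (Step K)) {n n' : ℕ} (h : n < K) (h' : n' < K) →
                      Balanced (palin q n h) → Balanced (palin q n' h')
  recentre-balanced q {n} {n'} h h' = insert n' h' ∘ remove n h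
    where
    remove : (n : ℕ) (h : n < K) → Balanced (palin q n h) → Balanced (q ++ reflect q)
    remove zero    h = id
    remove (suc n) h = flat-remove q (reflect q)
    insert : (n : ℕ) (h : n < K) → Balanced (q ++ reflect q) → Balanced (palin q n h)
    insert zero    h = id
    insert (suc n) h = flat-insert q (reflect q)

  palin-Dyck-width : ∀ {s} (q : List (Step K)) {n} (h : n < K) →
                     IsDyck s K (palin q n h) → width q + n ≡ s
  palin-Dyck-width q {n} h (w , _) = *-cancelˡ-≡ _ _ 2 (trans (sym (palin-width q n h)) w)

  recentre-Dyck : ∀ {s s'} (q : List (Step K)) {n n'} (h : n < K) (h' : n' < K) →
                  IsDyck s K (palin q n h) → width q + n' ≡ s' → IsDyck s' K (palin q n' h')
  recentre-Dyck q {n' = n'} h h' (_ , bal) w' =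
    trans (palin-width q n' h') (cong (2 *_) w') , recentre-balanced q h h' bal

  -- Decidable equality of steps yields uniqueness of symmetry proofs.
  step-≟ : DecidableEquality (Step K)
  step-≟ U U = yes refl
  step-≟ U D = no (λ ())
  step-≟ U (H _ _ _) = no (λ ())
  step-≟ D U = no (λ ())
  step-≟ D D = yes refl
  step-≟ D (H _ _ _) = no (λ ())
  step-≟ (H _ _ _) U = no (λ ())
  step-≟ (H _ _ _) D = no (λ ())
  step-≟ (H ℓ u v) (H ℓ' u' v') with ℓ ≟ ℓ'
  ... | yes refl = yes (cong₂ (H ℓ) (≤-irrelevant u u') (<-irrelevant v v'))
  ... | no ℓ≢ℓ'  = no (λ { refl → ℓ≢ℓ' refl })

  SD-≡ : ∀ {s} {x y : SD s K} → proj₁ x ≡ proj₁ y → x ≡ y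
  SD-≡ {x = p , (w , ends , above) , sym-p} {y = .p , (w' , ends' , above') , sym-p'} refl =
    cong₂ (λ d s → p , d , s)
      (cong₂ _,_ (ℕ-≡-irrelevant w w')
                 (cong₂ _,_ (Decidable⇒UIP.≡-irrelevant ℤ._≟_ ends ends')
                            (All.irrelevant ℤP.≤-irrelevant above above')))
      (Decidable⇒UIP.≡-irrelevant (LP.≡-dec step-≟) sym-p sym-p')

width-even : ∀ k (q : List (Step (2 * k))) → 2 ∣ width q
width-even _ []            = divides 0 refl
width-even k (U ∷ q)       = ∣m∣n⇒∣m+n (m∣m*n k) (width-even k q)
width-even k (D ∷ q)       = ∣m∣n⇒∣m+n (m∣m*n k) (width-even k q)
width-even k (H ℓ _ _ ∷ q) = ∣m∣n⇒∣m+n (m∣m*n ℓ) (width-even k q)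

odd-not-even : ∀ m → ¬ 2 ∣ suc (2 * m)
odd-not-even m (divides q e) = even≢odd q m (trans (*-comm 2 q) (sym e))

even-suc-< : ∀ {n k} → 2 ∣ n → n < 2 * k → suc n < 2 * k
even-suc-< {k = k} (divides a refl) n<2k =
  ≤∧≢⇒< n<2k (λ e → even≢odd k a (trans (sym e) (cong suc (*-comm a 2))))

module Bijection (m k : ℕ) (1≤k : 1 ≤ k) where

  0<2k : 0 < 2 * k
  0<2k = ≤-trans 1≤k (m≤m+n k (k + 0))

  -- Centre n ↦ n + 1 on a palindrome of width 2·(2m); n is even, so n + 1 < 2k.
  grow : (q : List (Step (2 * k))) (n : ℕ) (h : n < 2 * k) →
         IsDyck (2 * m) (2 * k) (palin q n h) → SD (2 * m + 1) (2 * k)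
  grow q n h dy = palin q (suc n) h₊ , recentre-Dyck {s = 2 * m} {s' = 2 * m + 1} q h h₊ dy width₊ , palin-symmetric q (suc n) h₊
    where
    w : width q + n ≡ 2 * m
    w = palin-Dyck-width {s = 2 * m} q h dy
    h₊ : suc n < 2 * k
    h₊ = even-suc-< {k = k} (∣m+n∣m⇒∣n (subst (2 ∣_) (sym w) (m∣m*n m)) (width-even k q)) h
    width₊ : width q + suc n ≡ 2 * m + 1
    width₊ = trans (+-suc (width q) n) (trans (cong suc w) (+-comm 1 (2 * m)))

  shrink : (q : List (Step (2 * k))) (n : ℕ) (h : suc n < 2 * k) →
           IsDyck (2 * m + 1) (2 * k) (palin q (suc n) h) → SD (2 * m) (2 * k)
  shrink q n h dy = palin q n h₋ , recentre-Dyck {s = 2 * m + 1} {s' = 2 * m} q h h₋ dy width₋ , palin-symmetric q n h₋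
    where
    h₋ : n < 2 * k
    h₋ = <⇒≤ h
    width₋ : width q + n ≡ 2 * m
    width₋ = suc-injective (trans (sym (+-suc (width q) n))
                                  (trans (palin-Dyck-width {s = 2 * m + 1} q h dy) (+-comm (2 * m) 1)))

  odd-centre : (q : List (Step (2 * k))) (h : 0 < 2 * k) →
               ¬ IsDyck (2 * m + 1) (2 * k) (palin q 0 h)
  odd-centre q h dy = odd-not-even m (subst (2 ∣_) width≡odd (width-even k q))
    where
    width≡odd : width q ≡ suc (2 * m)
    width≡odd = trans (sym (+-identityʳ _)) (trans (palin-Dyck-width {s = 2 * m + 1} q h dy) (+-comm (2 * m) 1))

  grow-palindrome : ∀ {p} → IsDyck (2 * m) (2 * k) p → Palindrome p → SD (2 * m + 1) (2 * k)
  grow-palindrome dy (palindrome q n h e) = grow q n h (subst (IsDyck (2 * m) (2 * k)) e dy)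

  shrink-palindrome : ∀ {p} → IsDyck (2 * m + 1) (2 * k) p → Palindrome p → SD (2 * m) (2 * k)
  shrink-palindrome dy (palindrome q zero    h e) = ⊥-elim (odd-centre q h (subst (IsDyck (2 * m + 1) (2 * k)) e dy))
  shrink-palindrome dy (palindrome q (suc n) h e) = shrink q n h (subst (IsDyck (2 * m + 1) (2 * k)) e dy)

  to : SD (2 * m) (2 * k) → SD (2 * m + 1) (2 * k)
  to (p , dy , sym-p) = grow-palindrome dy (decompose 0<2k p sym-p)

  from : SD (2 * m + 1) (2 * k) → SD (2 * m) (2 * k)
  from (p , dy , sym-p) = shrink-palindrome dy (decompose 0<2k p sym-p)

  -- Round trips, for any decomposition of the intermediate path: by
  -- uniqueness it has the same half and the shifted centre.

  shrink-grow : ∀ {p} (dy : IsDyck (2 * m) (2 * k) p) (P : Palindrome p)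
                (P' : Palindrome (proj₁ (grow-palindrome dy P))) →
                proj₁ (shrink-palindrome (proj₁ (proj₂ (grow-palindrome dy P))) P') ≡ p
  shrink-grow dy (palindrome q n h e) (palindrome q' n' h' e') with palin-unique q q' e'
  ... | refl , refl = trans (cong (palin q n) (<-irrelevant _ _)) (sym e)

  grow-shrink : ∀ {p} (dy : IsDyck (2 * m + 1) (2 * k) p) (P : Palindrome p)
                (P' : Palindrome (proj₁ (shrink-palindrome dy P))) →
                proj₁ (grow-palindrome (proj₁ (proj₂ (shrink-palindrome dy P))) P') ≡ p
  grow-shrink dy (palindrome q zero h e) _ = ⊥-elim (odd-centre q h (subst (IsDyck (2 * m + 1) (2 * k)) e dy))
  grow-shrink dy (palindrome q (suc n) h e) (palindrome q' n' h' e') with palin-unique q q' e'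
  ... | refl , refl = trans (cong (palin q (suc n)) (<-irrelevant _ _)) (sym e)

  from∘to : ∀ x → from (to x) ≡ x
  from∘to (p , dy , sym-p) = SD-≡ {s = 2 * m} (shrink-grow dy (decompose 0<2k p sym-p) (decompose 0<2k _ _))

  to∘from : ∀ y → to (from y) ≡ y
  to∘from (p , dy , sym-p) = SD-≡ {s = 2 * m + 1} (grow-shrink dy (decompose 0<2k p sym-p) (decompose 0<2k _ _))

lemma2p21 : (m k : ℕ) → 1 ≤ m → 1 ≤ k → SD (2 * m) (2 * k) ⤖ SD (2 * m + 1) (2 * k)
lemma2p21 m k _ 1≤k = ↔⇒⤖ (mk↔ₛ′ to from to∘from from∘to)
  where open Bijection m k 1≤k
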